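{- Let $M=\langle W,W^\bot,\preceq,\equiv,V\rangle$ be a $\mathsf{CK}$-model whose modal relation $\equiv$ is an equivalence relation on $W$. Then $\equiv$ is forward confluent if and only if $\equiv$ is backward confluent.
   Context: A $\mathsf{CK}$-model is $\langle W,W^\bot,\preceq,R,V\rangle$ with $W^\bot\subseteq W$, $\preceq$ a preorder on $W$ (intuitionistic relation), $R$ a relation on $W$ (modal relation), $V$ a valuation upward closed under $\preceq$ with $W^\bot\subseteq V(P)$, and $W^\bot$ closed under $\preceq$- and $R$-successors. The modal relation $\equiv$ is forward confluent iff $w\equiv v$ and $w\preceq w'$ imply there is $v'$ with $v\preceq v'$ and $w'\equiv v'$; it is backward confluent iff $w\equiv v\preceq v'$ implies there is $w'$ with $w\preceq w'\equiv v'$. -}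

module Defs where

open import Level using (Level; _⊔_; suc)
open import Data.Product using (Σ; _×_; ∃-syntax)
open import Relation.Binary using (IsPreorder; IsEquivalence; _⇒_)
open import Relation.Binary.PropositionalEquality using (_≡_)

record CKModel (a ℓ : Level) (Atom : Set a) : Set (suc (a ⊔ ℓ)) where
  field
    W      : Set ℓ
    W⊥     : W → Set ℓ
    _≼_    : W → W → Set ℓ
    R      : W → W → Set ℓ
    V      : Atom → W → Set ℓ
    ≼-isPreorder : IsPreorder _≡_ _≼_
    V-mono : ∀ p {w w′} → w ≼ w′ → V p w → V p w′
    W⊥⊆V   : ∀ p {w} → W⊥ w → V p w
    W⊥-≼-closed : ∀ {w w′} → w ≼ w′ → W⊥ w → W⊥ w′
    W⊥-R-closed : ∀ {w w′} → R w w′ → W⊥ w → W⊥ w′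

module _ {a ℓ : Level} {Atom : Set a} (M : CKModel a ℓ Atom) where
  open CKModel M

  ForwardConfluent : Set ℓ
  ForwardConfluent = ∀ {w v w′} → R w v → w ≼ w′ → ∃[ v′ ] (v ≼ v′ × R w′ v′)

  BackwardConfluent : Set ℓ
  BackwardConfluent = ∀ {w v v′} → R w v → v ≼ v′ → ∃[ w′ ] (w ≼ w′ × R w′ v′)

module Submission where

open import Defs
open import Level using (Level)
open import Data.Product using (_×_; _,_)
open import Relation.Binary using (IsEquivalence; Symmetric)

module _ {a ℓ : Level} {Atom : Set a} (M : CKModel a ℓ Atom) where
  open CKModel M

  forward⇒backward : Symmetric R → ForwardConfluent M → BackwardConfluent M
  forward⇒backward sym fc wRv v≼v′ with fc (sym wRv) v≼v′
  ... | w′ , w≼w′ , v′Rw′ = w′ , w≼w′ , sym v′Rw′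

  backward⇒forward : Symmetric R → BackwardConfluent M → ForwardConfluent M
  backward⇒forward sym bc wRv w≼w′ with bc (sym wRv) w≼w′
  ... | v′ , v≼v′ , v′Rw′ = v′ , v≼v′ , sym v′Rw′

mainTheorem9 : {a ℓ : Level} {Atom : Set a} (M : CKModel a ℓ Atom) →
    IsEquivalence (CKModel.R M) →
    (ForwardConfluent M → BackwardConfluent M) × (BackwardConfluent M → ForwardConfluent M)
mainTheorem9 M isEquivalence =
  forward⇒backward M sym , backward⇒forward M sym
  where open IsEquivalence isEquivalence using (sym)
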